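{- Fix $1\le p\le n$, a $p$-element subset $Y\subseteq[n]$ and $w\in\mathfrak S_n$ with $Y\le\{w_1,\dots,w_p\}$, and let $\sigma\in\mathfrak S_n$ be produced by the maximal-lift procedure described in the context. If $1\le i\le n-1$, $i\ne p$, and $w_i>w_{i+1}$, then $\sigma_i>\sigma_{i+1}$. Equivalently, $\mathrm{Des}(w)\setminus\{p\}\subseteq\mathrm{Des}(\sigma)$, where $\mathrm{Des}(\eta)=\{1\le i\le n-1:\eta_i>\eta_{i+1}\}$.
   Context: For a subset $E\subseteq[n]$, $\tilde e_k$ is its $k$-th smallest element; for $t$-element subsets, $E\le F$ means $\tilde e_k\le\tilde f_k$ for all $k$. Sub-procedure $P$: inputs are $t$-element subsets $A,B$ with $B\le A$ and $\gamma\in[n]\setminus A$. Put $A'=A\cup\{\gamma\}$, let $q$ be least, $1\le q\le t+1$, with $\tilde b_q\not\le\tilde a'_q$ (where $\tilde b_{t+1}=\infty$), output $a'=\tilde a'_q$, and update $A,B$ to $A'$, $B'=B\cup\{a'\}$. Maximal-lift procedure: for $1\le j\le p$, $\sigma_j$ is the maximum element of $Y\setminus\{\sigma_1,\dots,\sigma_{j-1}\}$ not exceeding $w_j$. Then $\sigma_{p+1}$ is the output of $P$ with $A=\{w_1,\dots,w_p\}$, $B=Y$, $\gamma=w_{p+1}$; for $j>p+1$, $\sigma_j$ is the output of $P$ run with the updated $A,B$ of the previous run and $\gamma=w_j$. -}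

module Defs where

open import Data.Nat using (ℕ; zero; suc; _≤_; _<_; _≤ᵇ_)
open import Data.Nat.Properties using (≤-decTotalOrder)
open import Data.Bool using (Bool; true; false; if_then_else_)
open import Data.List using (List; []; _∷_; _++_; take; drop; map; upTo; length)
open import Data.List.Relation.Binary.Pointwise using (Pointwise)
import Data.List.Sort.InsertionSort

open Data.List.Sort.InsertionSort ≤-decTotalOrder public using (sort)

[_] : ℕ → List ℕ
[ n ] = map suc (upTo n)

-- 1-indexed lookup: η ! k = η_k (default 0 if out of range)
_!_ : List ℕ → ℕ → ℕ
[]       ! _           = 0
(x ∷ xs) ! zero        = 0
(x ∷ xs) ! suc zero    = x
(x ∷ xs) ! suc (suc k) = xs ! suc k

-- E ≤ F for equal-size subsets: k-th smallest elements compared pointwise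
_⊴_ : List ℕ → List ℕ → Set
E ⊴ F = Pointwise _≤_ (sort E) (sort F)

-- maximum element of xs not exceeding v (0 if none)
maxBelow : ℕ → List ℕ → ℕ
maxBelow v []       = 0
maxBelow v (x ∷ xs) with x ≤ᵇ v | maxBelow v xs
... | true  | m = if x ≤ᵇ m then m else x
... | false | m = m

remove : ℕ → List ℕ → List ℕ
remove s []       = []
remove s (x ∷ xs) = if (s ≤ᵇ x) Data.Bool.∧ (x ≤ᵇ s) then xs else x ∷ remove s xs

-- Given sorted A' = (a'_1,...) and sorted B = (b_1,...), return a'_q for the
-- least q with b_q ≰ a'_q (b beyond the end of B is ∞).
pick : List ℕ → List ℕ → ℕ
pick []        _        = 0
pick (a ∷ as) []        = a
pick (a ∷ as) (b ∷ bs)  = if b ≤ᵇ a then pick as bs else a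

-- sub-procedure P: returns the output a' of one run with A, B, γ;
-- the updated sets are A ∪ {γ} and B ∪ {a'}.
P-out : List ℕ → List ℕ → ℕ → ℕ
P-out A B γ = pick (sort (γ ∷ A)) (sort B)

firstPart : List ℕ → List ℕ → List ℕ
firstPart Y []       = []
firstPart Y (v ∷ vs) = maxBelow v Y ∷ firstPart (remove (maxBelow v Y) Y) vs

secondPart : List ℕ → List ℕ → List ℕ → List ℕ
secondPart A B []       = []
secondPart A B (γ ∷ γs) = P-out A B γ ∷ secondPart (γ ∷ A) (P-out A B γ ∷ B) γs

maximalLift : ℕ → List ℕ → List ℕ → List ℕ
maximalLift p Y w = firstPart Y (take p w) ++ secondPart (take p w) Y (drop p w)

IsDescent : List ℕ → ℕ → Set
IsDescent η i = η ! suc i < η ! i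

-- Write c_v(E) = #{e ∈ E | e ≤ v}. For sets of equal size, E ≤ F holds iff
-- c_v(F) ≤ c_v(E) for every v, and this is the invariant driving both phases.
-- In the second phase B ≤ A holds before each run of P, and the output a' of P
-- is the least v at which c_v(A ∪ {γ}) exceeds c_v(B); in particular a' ∉ B and
-- γ ≤ a'. If the next input γ' is smaller than γ, then at v = a' the sets
-- A ∪ {γ, γ'} and B ∪ {a'} still show the excess just created, so the next
-- output lies strictly below a'. In the first phase the invariant
-- Y ∖ {σ_1, …, σ_{j-1}} ≤ {w_j, …, w_p} guarantees that σ_j exists; after a
-- descent w_j > w_{j+1} the element σ_{j+1} is a remaining element of Y below w_j,
-- so σ_{j+1} ≤ σ_j, strictly because Y has no repeated elements.
module Submission where

open import Defs
open import Data.Nat using (ℕ; zero; suc; _+_; _⊔_; _≤_; _<_; _≤ᵇ_; z≤n; s≤s; s≤s⁻¹; z<s)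
open import Data.Nat.Properties
open import Data.Bool using (true; false; if_then_else_)
open import Data.Product using (_,_)
open import Data.Sum using (inj₁; inj₂)
open import Data.List using (List; []; _∷_; _++_; take; drop; length; map; upTo)
open import Data.List.Properties using (length-take; take++drop≡id; length-map; length-upTo)
open import Data.List.Relation.Unary.All as All using (All; []; _∷_)
open import Data.List.Relation.Unary.AllPairs as AllPairs using (_∷_)
open import Data.List.Relation.Unary.Any using (here; there)
import Data.List.Relation.Unary.Linked as Linked
open import Data.List.Relation.Unary.Linked.Properties using (Linked⇒All)
open import Data.List.Relation.Unary.Sorted.TotalOrder ≤-totalOrder using (Sorted)
open import Data.List.Relation.Unary.Unique.Propositional using (Unique)
open import Data.List.Relation.Unary.Unique.Propositional.Properties
  using (map⁺; upTo⁺; Unique[x∷xs]⇒x∉xs)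
open import Data.List.Membership.Propositional using (_∈_; _∉_)
open import Data.List.Relation.Binary.Permutation.Propositional
  using (_↭_; refl; prep; swap; trans; ↭-sym; ↭⇒↭ₛ)
open import Data.List.Relation.Binary.Permutation.Propositional.Properties
  using (∈-resp-↭; ↭-length; shift; shifts; ++-comm)
import Data.List.Relation.Binary.Permutation.Setoid.Properties as ↭ₛ
open import Data.List.Relation.Binary.Pointwise using (Pointwise; []; _∷_)
open import Data.List.Sort.InsertionSort.Properties ≤-decTotalOrder using (sort-↭; sort-↗)
open import Relation.Binary.PropositionalEquality as ≡
  using (_≡_; _≢_; refl; sym; cong; subst; subst₂; setoid)
open import Function.Bundles using (_⇔_; mk⇔; module Equivalence)
open Equivalence using (to; from)
open import Relation.Nullary using (yes; no; contradiction)
open import Relation.Nullary.Reflects using (ofʸ; ofⁿ)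
open import Relation.Binary.Definitions using (tri<; tri≈; tri>)

Unique-resp-↭ : ∀ {xs ys : List ℕ} → xs ↭ ys → Unique xs → Unique ys
Unique-resp-↭ p = ↭ₛ.Unique-resp-↭ (setoid ℕ) (↭⇒↭ₛ p)

Unique-++⁻ʳ : ∀ xs {ys : List ℕ} → Unique (xs ++ ys) → Unique ys
Unique-++⁻ʳ []       u       = u
Unique-++⁻ʳ (x ∷ xs) (_ ∷ u) = Unique-++⁻ʳ xs u

count≤ : ℕ → List ℕ → ℕ
count≤ v []       = 0
count≤ v (x ∷ xs) = if x ≤ᵇ v then suc (count≤ v xs) else count≤ v xs

count≤-∷-≤ : ∀ {a v} as → a ≤ v → count≤ v (a ∷ as) ≡ suc (count≤ v as)
count≤-∷-≤ {a} {v} as a≤v with a ≤ᵇ v | ≤ᵇ-reflects-≤ a v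
... | true  | _        = refl
... | false | ofⁿ a≰v = contradiction a≤v a≰v

count≤-∷-> : ∀ {a v} as → v < a → count≤ v (a ∷ as) ≡ count≤ v as
count≤-∷-> {a} {v} as v<a with a ≤ᵇ v | ≤ᵇ-reflects-≤ a v
... | false | _        = refl
... | true  | ofʸ a≤v = contradiction a≤v (<⇒≱ v<a)

count≤-∷ : ∀ a as v → count≤ v as ≤ count≤ v (a ∷ as)
count≤-∷ a as v with a ≤ᵇ v
... | true  = n≤1+n _
... | false = ≤-refl

count≤-mono : ∀ xs {u v} → u ≤ v → count≤ u xs ≤ count≤ v xs
count≤-mono []       u≤v = z≤n
count≤-mono (x ∷ xs) {u} {v} u≤v
  with x ≤ᵇ u | ≤ᵇ-reflects-≤ x u | x ≤ᵇ v | ≤ᵇ-reflects-≤ x v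
... | true  | _        | true  | _        = s≤s (count≤-mono xs u≤v)
... | true  | ofʸ x≤u | false | ofⁿ x≰v = contradiction (≤-trans x≤u u≤v) x≰v
... | false | _        | true  | _        = m≤n⇒m≤1+n (count≤-mono xs u≤v)
... | false | _        | false | _        = count≤-mono xs u≤v

count≤-↭ : ∀ v {xs ys} → xs ↭ ys → count≤ v xs ≡ count≤ v ys
count≤-↭ v refl = refl
count≤-↭ v (prep x p) with x ≤ᵇ v
... | true  = cong suc (count≤-↭ v p)
... | false = count≤-↭ v p
count≤-↭ v (swap x y p) with x ≤ᵇ v | y ≤ᵇ v
... | true  | true  = cong (λ c → suc (suc c)) (count≤-↭ v p)
... | true  | false = cong suc (count≤-↭ v p)
... | false | true  = cong suc (count≤-↭ v p)
... | false | false = count≤-↭ v p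
count≤-↭ v (trans p q) = ≡.trans (count≤-↭ v p) (count≤-↭ v q)

count≤-all> : ∀ {v} xs → All (v <_) xs → count≤ v xs ≡ 0
count≤-all> []       []          = refl
count≤-all> (x ∷ xs) (v<x ∷ v<xs) =
  ≡.trans (count≤-∷-> xs v<x) (count≤-all> xs v<xs)

count≤-gap : ∀ xs {u v} → (∀ {z} → z ∈ xs → z ≤ v → z ≤ u) → u ≤ v →
             count≤ u xs ≡ count≤ v xs
count≤-gap []       gap u≤v = refl
count≤-gap (x ∷ xs) {u} {v} gap u≤v
  with x ≤ᵇ u | ≤ᵇ-reflects-≤ x u | x ≤ᵇ v | ≤ᵇ-reflects-≤ x v
... | true  | _        | true  | _        = cong suc (count≤-gap xs (λ z∈xs → gap (there z∈xs)) u≤v)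
... | true  | ofʸ x≤u | false | ofⁿ x≰v = contradiction (≤-trans x≤u u≤v) x≰v
... | false | ofⁿ x≰u | true  | ofʸ x≤v = contradiction (gap (here refl) x≤v) x≰u
... | false | _        | false | _        = count≤-gap xs (λ z∈xs → gap (there z∈xs)) u≤v

Sorted-head-< : ∀ {a as} → Sorted (a ∷ as) → Unique (a ∷ as) → All (a <_) as
Sorted-head-< as↗ (a∉as ∷ _) =
  All.zipWith (λ (a≤x , a≢x) → ≤∧≢⇒< a≤x a≢x) (All.tail (Linked⇒All ≤-trans ≤-refl as↗) , a∉as)

count≤-sorted-below : ∀ {a v} as → Sorted (a ∷ as) → v < a → count≤ v (a ∷ as) ≡ 0
count≤-sorted-below as as↗ v<a =
  count≤-all> (_ ∷ as) (All.map (<-≤-trans v<a) (Linked⇒All ≤-trans ≤-refl as↗))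

-- B ≼ A is the paper's B ≤ A (for lists of equal length; see ⊴⇒≼).
record _≼_ (B A : List ℕ) : Set where
  field ≼⇒count≤ : ∀ v → count≤ v A ≤ count≤ v B
open _≼_ public

≼-resp-↭ : ∀ {A A′ B B′} → A ↭ A′ → B ↭ B′ → B ≼ A → B′ ≼ A′
≼⇒count≤ (≼-resp-↭ A↭A′ B↭B′ B≼A) v = subst₂ _≤_ (count≤-↭ v A↭A′) (count≤-↭ v B↭B′) (≼⇒count≤ B≼A v)

pointwise⇒≼ : ∀ {bs as} → Sorted bs → Sorted as → Pointwise _≤_ bs as → bs ≼ as
≼⇒count≤ (pointwise⇒≼ _ _ []) v = z≤n
≼⇒count≤ (pointwise⇒≼ {b ∷ bs} {a ∷ as} bs↗ as↗ (b≤a ∷ bs≤as)) v with a ≤? v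
... | yes a≤v = begin
  count≤ v (a ∷ as)   ≡⟨ count≤-∷-≤ as a≤v ⟩
  suc (count≤ v as)   ≤⟨ s≤s (≼⇒count≤ (pointwise⇒≼ (Linked.tail bs↗) (Linked.tail as↗) bs≤as) v) ⟩
  suc (count≤ v bs)   ≡⟨ count≤-∷-≤ bs (≤-trans b≤a a≤v) ⟨
  count≤ v (b ∷ bs)   ∎
  where open ≤-Reasoning
... | no a≰v = subst (_≤ count≤ v (b ∷ bs)) (sym (count≤-sorted-below as as↗ (≰⇒> a≰v))) z≤n

⊴⇒≼ : ∀ {E F} → E ⊴ F → E ≼ F
⊴⇒≼ {E} {F} E⊴F = ≼-resp-↭ (sort-↭ F) (sort-↭ E) (pointwise⇒≼ (sort-↗ E) (sort-↗ F) E⊴F)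

record LeastExcess (A B : List ℕ) (x : ℕ) : Set where
  field
    ∈A     : x ∈ A
    ∉B     : x ∉ B
    excess : count≤ x B < count≤ x A
    below  : ∀ {v} → v < x → count≤ v A ≤ count≤ v B

LeastExcess-resp-↭ : ∀ {A A′ B B′ x} → A ↭ A′ → B ↭ B′ → LeastExcess A B x → LeastExcess A′ B′ x
LeastExcess-resp-↭ {x = x} A↭A′ B↭B′ e = record
  { ∈A     = ∈-resp-↭ A↭A′ ∈A
  ; ∉B     = λ x∈B′ → ∉B (∈-resp-↭ (↭-sym B↭B′) x∈B′)
  ; excess = subst₂ _<_ (count≤-↭ x B↭B′) (count≤-↭ x A↭A′) excess
  ; below  = λ {v} v<x → subst₂ _≤_ (count≤-↭ v A↭A′) (count≤-↭ v B↭B′) (below v<x)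
  }
  where open LeastExcess e

pick-leastExcess : ∀ {as bs} → Sorted as → Unique as → Sorted bs → length bs < length as →
                   LeastExcess as bs (pick as bs)
pick-leastExcess {a ∷ as} {[]} as↗ _ _ _ = record
  { ∈A     = here refl
  ; ∉B     = λ ()
  ; excess = subst (0 <_) (sym (count≤-∷-≤ as ≤-refl)) z<s
  ; below  = λ v<a → ≤-reflexive (count≤-sorted-below as as↗ v<a)
  }
pick-leastExcess {a ∷ as} {b ∷ bs} as↗ as! bs↗ (s≤s len<) with b ≤ᵇ a | ≤ᵇ-reflects-≤ b a
... | true | ofʸ b≤a = record
  { ∈A     = there ∈A
  ; ∉B     = λ { (here x≡b) → <-irrefl (sym x≡b) (≤-<-trans b≤a a<x) ; (there x∈bs) → ∉B x∈bs }
  ; excess = subst₂ _<_ (sym (count≤-∷-≤ bs (≤-trans b≤a (<⇒≤ a<x))))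
                        (sym (count≤-∷-≤ as (<⇒≤ a<x))) (s≤s excess)
  ; below  = below′
  }
  where
  open LeastExcess (pick-leastExcess (Linked.tail as↗) (AllPairs.tail as!) (Linked.tail bs↗) len<)
  a<x : a < pick as bs
  a<x = All.lookup (Sorted-head-< as↗ as!) ∈A
  below′ : ∀ {v} → v < pick as bs → count≤ v (a ∷ as) ≤ count≤ v (b ∷ bs)
  below′ {v} v<x with a ≤? v
  ... | yes a≤v = subst₂ _≤_ (sym (count≤-∷-≤ as a≤v)) (sym (count≤-∷-≤ bs (≤-trans b≤a a≤v)))
                         (s≤s (below v<x))
  ... | no a≰v = subst (_≤ _) (sym (count≤-sorted-below as as↗ (≰⇒> a≰v))) z≤n
... | false | ofⁿ b≰a = record
  { ∈A     = here refl
  ; ∉B     = λ a∈B → <-irrefl refl (All.lookup a<B a∈B)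
  ; excess = subst₂ _<_ (sym (count≤-all> (b ∷ bs) a<B)) (sym (count≤-∷-≤ as ≤-refl)) z<s
  ; below  = λ v<a → subst (_≤ _) (sym (count≤-sorted-below as as↗ v<a)) z≤n
  }
  where
  a<B : All (a <_) (b ∷ bs)
  a<B = All.map (<-≤-trans (≰⇒> b≰a)) (Linked⇒All ≤-trans ≤-refl bs↗)

P-out-leastExcess : ∀ {A B γ} → length A ≡ length B → Unique (γ ∷ A) →
                    LeastExcess (γ ∷ A) B (P-out A B γ)
P-out-leastExcess {A} {B} {γ} |A|≡|B| γA! =
  LeastExcess-resp-↭ (sort-↭ (γ ∷ A)) (sort-↭ B)
    (pick-leastExcess (sort-↗ (γ ∷ A)) (Unique-resp-↭ (↭-sym (sort-↭ (γ ∷ A))) γA!) (sort-↗ B) |B|<|γA|)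
  where
  |B|<|γA| : length (sort B) < length (sort (γ ∷ A))
  |B|<|γA| = subst₂ _<_ (≡.trans |A|≡|B| (sym (↭-length (sort-↭ B))))
                        (sym (↭-length (sort-↭ (γ ∷ A)))) ≤-refl

module _ {A B γ x} (B≼A : B ≼ A) (e : LeastExcess (γ ∷ A) B x) where
  open LeastExcess e

  leastExcess-≥ : γ ≤ x
  leastExcess-≥ with γ ≤? x
  ... | yes γ≤x = γ≤x
  ... | no γ≰x = contradiction (subst (_≤ count≤ x B) (sym (count≤-∷-> A (≰⇒> γ≰x))) (≼⇒count≤ B≼A x))
                               (<⇒≱ excess)

  leastExcess-≼ : (x ∷ B) ≼ (γ ∷ A)
  ≼⇒count≤ leastExcess-≼ v with x ≤? v
  ... | yes x≤v = subst₂ _≤_ (sym (count≤-∷-≤ A (≤-trans leastExcess-≥ x≤v))) (sym (count≤-∷-≤ B x≤v))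
                         (s≤s (≼⇒count≤ B≼A v))
  ... | no x≰v = ≤-trans (below (≰⇒> x≰v)) (count≤-∷ x B v)

P-out-decreasing : ∀ {A B γ γ′} → B ≼ A → length A ≡ length B → Unique (γ′ ∷ γ ∷ A) → γ′ < γ →
                   P-out (γ ∷ A) (P-out A B γ ∷ B) γ′ < P-out A B γ
P-out-decreasing {A} {B} {γ} {γ′} B≼A |A|≡|B| γ′γA! γ′<γ = ≤∧≢⇒< y≤x y≢x
  where
  x = P-out A B γ
  y = P-out (γ ∷ A) (x ∷ B) γ′
  first : LeastExcess (γ ∷ A) B x
  first = P-out-leastExcess |A|≡|B| (AllPairs.tail γ′γA!)
  second : LeastExcess (γ′ ∷ γ ∷ A) (x ∷ B) y
  second = P-out-leastExcess (cong suc |A|≡|B|) γ′γA!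
  y≢x : y ≢ x
  y≢x y≡x = LeastExcess.∉B second (here y≡x)
  γ′≤x : γ′ ≤ x
  γ′≤x = ≤-trans (<⇒≤ γ′<γ) (leastExcess-≥ B≼A first)
  y≤x : y ≤ x
  y≤x = ≮⇒≥ λ x<y → <⇒≱ (LeastExcess.excess first)
    (s≤s⁻¹ (subst₂ _≤_ (count≤-∷-≤ (γ ∷ A) γ′≤x) (count≤-∷-≤ B ≤-refl) (LeastExcess.below second x<y)))

secondPart-descent : ∀ {A B} γs → B ≼ A → length A ≡ length B → Unique (γs ++ A) →
                     ∀ k → IsDescent γs (suc k) → IsDescent (secondPart A B γs) (suc k)
-- Past the end of a list `!` returns 0, so a descent at the last position only says γ > 0.
secondPart-descent (γ ∷ []) B≼A |A|≡|B| γA! zero 0<γ =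
  <-≤-trans 0<γ (leastExcess-≥ B≼A (P-out-leastExcess |A|≡|B| γA!))
secondPart-descent {A} {B} (γ ∷ γ′ ∷ γs) B≼A |A|≡|B| γγ′γsA! zero γ′<γ =
  P-out-decreasing B≼A |A|≡|B| (Unique-++⁻ʳ γs (Unique-resp-↭ γγ′γsA↭ γγ′γsA!)) γ′<γ
  where
  γγ′γsA↭ : γ ∷ γ′ ∷ γs ++ A ↭ γs ++ γ′ ∷ γ ∷ A
  γγ′γsA↭ = trans (swap γ γ′ refl) (shifts (γ′ ∷ γ ∷ []) γs)
secondPart-descent {A} {B} (γ ∷ γ′ ∷ γs) B≼A |A|≡|B| γγ′γsA! (suc k) d =
  secondPart-descent (γ′ ∷ γs) (leastExcess-≼ B≼A (P-out-leastExcess |A|≡|B| γA!)) (cong suc |A|≡|B|)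
    γ′γsγA! k d
  where
  γ′γsγA! : Unique (γ′ ∷ γs ++ γ ∷ A)
  γ′γsγA! = Unique-resp-↭ (↭-sym (shift γ (γ′ ∷ γs) A)) γγ′γsA!
  γA! : Unique (γ ∷ A)
  γA! = Unique-++⁻ʳ (γ′ ∷ γs) γ′γsγA!

maxBelow-∷-≤ : ∀ {x v} xs → x ≤ v → maxBelow v (x ∷ xs) ≡ x ⊔ maxBelow v xs
maxBelow-∷-≤ {x} {v} xs x≤v with x ≤ᵇ v | ≤ᵇ-reflects-≤ x v
... | false | ofⁿ x≰v = contradiction x≤v x≰v
... | true  | _ with x ≤ᵇ maxBelow v xs | ≤ᵇ-reflects-≤ x (maxBelow v xs)
...   | true  | ofʸ x≤m = sym (m≤n⇒m⊔n≡n x≤m)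
...   | false | ofⁿ x≰m = sym (m≥n⇒m⊔n≡m (<⇒≤ (≰⇒> x≰m)))

maxBelow-∷-> : ∀ {x v} xs → v < x → maxBelow v (x ∷ xs) ≡ maxBelow v xs
maxBelow-∷-> {x} {v} xs v<x with x ≤ᵇ v | ≤ᵇ-reflects-≤ x v
... | false | _        = refl
... | true  | ofʸ x≤v = contradiction x≤v (<⇒≱ v<x)

maxBelow-≤ : ∀ v xs → maxBelow v xs ≤ v
maxBelow-≤ v []       = z≤n
maxBelow-≤ v (x ∷ xs) with x ≤? v
... | yes x≤v = subst (_≤ v) (sym (maxBelow-∷-≤ xs x≤v)) (⊔-lub x≤v (maxBelow-≤ v xs))
... | no x≰v  = subst (_≤ v) (sym (maxBelow-∷-> xs (≰⇒> x≰v))) (maxBelow-≤ v xs)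

maxBelow-maximal : ∀ {v z} xs → z ∈ xs → z ≤ v → z ≤ maxBelow v xs
maxBelow-maximal {v} (x ∷ xs) z∈ z≤v with x ≤? v | z∈
... | yes x≤v | here refl = subst (_ ≤_) (sym (maxBelow-∷-≤ xs x≤v)) (m≤m⊔n x _)
... | yes x≤v | there z∈xs =
  subst (_ ≤_) (sym (maxBelow-∷-≤ xs x≤v)) (≤-trans (maxBelow-maximal xs z∈xs z≤v) (m≤n⊔m x _))
... | no x≰v | here refl = contradiction z≤v x≰v
... | no x≰v | there z∈xs = subst (_ ≤_) (sym (maxBelow-∷-> xs (≰⇒> x≰v))) (maxBelow-maximal xs z∈xs z≤v)

maxBelow-none : ∀ {v} xs → count≤ v xs ≡ 0 → maxBelow v xs ≡ 0
maxBelow-none []       _ = refl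
maxBelow-none {v} (x ∷ xs) none with x ≤? v
... | yes x≤v = contradiction (≡.trans (sym (count≤-∷-≤ xs x≤v)) none) λ ()
... | no x≰v  = ≡.trans (maxBelow-∷-> xs (≰⇒> x≰v))
                        (maxBelow-none xs (≡.trans (sym (count≤-∷-> xs (≰⇒> x≰v))) none))

maxBelow-∈ : ∀ {v} xs → 0 < count≤ v xs → maxBelow v xs ∈ xs
maxBelow-∈ {v} (x ∷ xs) some with x ≤? v
... | no x≰v = subst (_∈ x ∷ xs) (sym (maxBelow-∷-> xs (≰⇒> x≰v)))
                     (there (maxBelow-∈ xs (subst (0 <_) (count≤-∷-> xs (≰⇒> x≰v)) some)))
... | yes x≤v = subst (_∈ x ∷ xs) (sym (maxBelow-∷-≤ xs x≤v)) x⊔m∈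
  where
  x⊔m∈ : x ⊔ maxBelow v xs ∈ x ∷ xs
  x⊔m∈ with count≤ v xs in c | ⊔-sel x (maxBelow v xs)
  -- when nothing in xs lies below v, maxBelow v xs is the default value 0
  ... | zero  | _      = here (≡.trans (cong (x ⊔_) (maxBelow-none xs c)) (⊔-identityʳ x))
  ... | suc _ | inj₁ e = here e
  ... | suc _ | inj₂ e = there (subst (_∈ xs) (sym e) (maxBelow-∈ xs (subst (0 <_) (sym c) z<s)))

remove-head : ∀ x xs → remove x (x ∷ xs) ≡ xs
remove-head x xs with x ≤ᵇ x | ≤ᵇ-reflects-≤ x x
... | true  | _        = refl
... | false | ofⁿ x≰x = contradiction ≤-refl x≰x

remove-≢ : ∀ {s x} xs → s ≢ x → remove s (x ∷ xs) ≡ x ∷ remove s xs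
remove-≢ {s} {x} xs s≢x with s ≤ᵇ x | ≤ᵇ-reflects-≤ s x | x ≤ᵇ s | ≤ᵇ-reflects-≤ x s
... | true  | ofʸ s≤x | true  | ofʸ x≤s = contradiction (≤-antisym s≤x x≤s) s≢x
... | true  | _        | false | _        = refl
... | false | _        | _     | _        = refl

remove-↭ : ∀ {s xs} → s ∈ xs → xs ↭ s ∷ remove s xs
remove-↭ {s} {x ∷ xs} s∈ with s ≟ x | s∈
... | yes refl | _ = subst (x ∷ xs ↭_) (cong (x ∷_) (sym (remove-head x xs))) refl
... | no s≢x | here s≡x = contradiction s≡x s≢x
... | no s≢x | there s∈xs = subst (x ∷ xs ↭_) (cong (s ∷_) (sym (remove-≢ xs s≢x)))
                                  (trans (prep x (remove-↭ s∈xs)) (swap x s refl))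

≼-∷⇒maxBelow-∈ : ∀ {Y v ws} → Y ≼ (v ∷ ws) → maxBelow v Y ∈ Y
≼-∷⇒maxBelow-∈ {Y} {v} {ws} Y≼vws =
  maxBelow-∈ Y (<-≤-trans (subst (0 <_) (sym (count≤-∷-≤ ws ≤-refl)) z<s) (≼⇒count≤ Y≼vws v))

module _ {Y v ws} (Y≼vws : Y ≼ (v ∷ ws)) where
  private
    m = maxBelow v Y
    Y′ = remove m Y
    m∈Y : m ∈ Y
    m∈Y = ≼-∷⇒maxBelow-∈ Y≼vws

    count≤-ws<count≤-Y : ∀ {u} → m ≤ u → count≤ u ws < count≤ u Y
    count≤-ws<count≤-Y {u} m≤u with v ≤? u
    ... | yes v≤u = subst (_≤ count≤ u Y) (count≤-∷-≤ ws v≤u) (≼⇒count≤ Y≼vws u)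
    ... | no v≰u = begin
      suc (count≤ u ws)   ≤⟨ s≤s (count≤-mono ws (<⇒≤ u<v)) ⟩
      suc (count≤ v ws)   ≡⟨ count≤-∷-≤ ws ≤-refl ⟨
      count≤ v (v ∷ ws)   ≤⟨ ≼⇒count≤ Y≼vws v ⟩
      count≤ v Y          ≡⟨ count≤-gap Y (λ z∈Y z≤v → ≤-trans (maxBelow-maximal Y z∈Y z≤v) m≤u) (<⇒≤ u<v) ⟨
      count≤ u Y          ∎
      where
      open ≤-Reasoning
      u<v = ≰⇒> v≰u

  remove-maxBelow-≼ : remove (maxBelow v Y) Y ≼ ws
  ≼⇒count≤ remove-maxBelow-≼ u with m ≤? u
  ... | no m≰u = begin
    count≤ u ws         ≤⟨ count≤-∷ v ws u ⟩
    count≤ u (v ∷ ws)   ≤⟨ ≼⇒count≤ Y≼vws u ⟩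
    count≤ u Y          ≡⟨ count≤-↭ u (remove-↭ m∈Y) ⟩
    count≤ u (m ∷ Y′)   ≡⟨ count≤-∷-> Y′ (≰⇒> m≰u) ⟩
    count≤ u Y′         ∎
    where open ≤-Reasoning
  ... | yes m≤u = s≤s⁻¹ (begin
    suc (count≤ u ws)   ≤⟨ count≤-ws<count≤-Y m≤u ⟩
    count≤ u Y          ≡⟨ count≤-↭ u (remove-↭ m∈Y) ⟩
    count≤ u (m ∷ Y′)   ≡⟨ count≤-∷-≤ Y′ m≤u ⟩
    suc (count≤ u Y′)   ∎)
    where open ≤-Reasoning

firstPart-descent : ∀ {Y} ws → Unique Y → Y ≼ ws → ∀ k → suc k < length ws →
                    IsDescent ws (suc k) → IsDescent (firstPart Y ws) (suc k)
firstPart-descent {Y} (v ∷ v′ ∷ ws) Y! Y≼vv′ws zero _ v′<v = ≤∧≢⇒< m′≤m m′≢m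
  where
  m = maxBelow v Y
  Y′ = remove m Y
  m′ = maxBelow v′ Y′
  m∈Y : m ∈ Y
  m∈Y = ≼-∷⇒maxBelow-∈ Y≼vv′ws
  m′∈Y′ : m′ ∈ Y′
  m′∈Y′ = ≼-∷⇒maxBelow-∈ (remove-maxBelow-≼ Y≼vv′ws)
  m′≤m : m′ ≤ m
  m′≤m = maxBelow-maximal Y (∈-resp-↭ (↭-sym (remove-↭ m∈Y)) (there m′∈Y′))
                            (≤-trans (maxBelow-≤ v′ Y′) (<⇒≤ v′<v))
  m′≢m : m′ ≢ m
  m′≢m m′≡m = Unique[x∷xs]⇒x∉xs (Unique-resp-↭ (remove-↭ m∈Y) Y!) (subst (_∈ Y′) m′≡m m′∈Y′)
firstPart-descent {Y} (v ∷ v′ ∷ ws) Y! Y≼vv′ws (suc k) (s≤s k<) d =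
  firstPart-descent (v′ ∷ ws) (AllPairs.tail (Unique-resp-↭ (remove-↭ (≼-∷⇒maxBelow-∈ Y≼vv′ws)) Y!))
                    (remove-maxBelow-≼ Y≼vv′ws) k k< d
firstPart-descent (v ∷ []) _ _ zero (s≤s ()) _

length-firstPart : ∀ Y ws → length (firstPart Y ws) ≡ length ws
length-firstPart Y []       = refl
length-firstPart Y (v ∷ ws) = cong suc (length-firstPart _ ws)

!-++ˡ : ∀ xs ys k → k < length xs → (xs ++ ys) ! suc k ≡ xs ! suc k
!-++ˡ (x ∷ xs) ys zero    _         = refl
!-++ˡ (x ∷ xs) ys (suc k) (s≤s k<) = !-++ˡ xs ys k k<

!-++ʳ : ∀ xs ys k → (xs ++ ys) ! suc (length xs + k) ≡ ys ! suc k
!-++ʳ []       ys k = refl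
!-++ʳ (x ∷ xs) ys k = !-++ʳ xs ys k

IsDescent-++ˡ : ∀ {ℓ} xs ys k → length xs ≡ ℓ → suc k < ℓ →
                IsDescent xs (suc k) ⇔ IsDescent (xs ++ ys) (suc k)
IsDescent-++ˡ xs ys k refl k< =
  mk⇔ (subst₂ _<_ (sym (!-++ˡ xs ys (suc k) k<)) (sym (!-++ˡ xs ys k (<⇒≤ k<))))
      (subst₂ _<_ (!-++ˡ xs ys (suc k) k<) (!-++ˡ xs ys k (<⇒≤ k<)))

IsDescent-++ʳ : ∀ {ℓ} xs ys k → length xs ≡ ℓ →
                IsDescent ys (suc k) ⇔ IsDescent (xs ++ ys) (suc (ℓ + k))
IsDescent-++ʳ xs ys k refl = mk⇔ (subst₂ _<_ (sym at-suc-k) (sym at-k)) (subst₂ _<_ at-suc-k at-k)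
  where
  at-suc-k : (xs ++ ys) ! suc (suc (length xs + k)) ≡ ys ! suc (suc k)
  at-suc-k = ≡.trans (cong (λ j → (xs ++ ys) ! suc j) (sym (+-suc (length xs) k))) (!-++ʳ xs ys (suc k))
  at-k : (xs ++ ys) ! suc (length xs + k) ≡ ys ! suc k
  at-k = !-++ʳ xs ys k

module _ {p Y w} (Y⊴W₁ : Y ⊴ take p w) (p≤|w| : p ≤ length w) where
  private
    W₁ = take p w
    W₂ = drop p w
    L₁ = firstPart Y W₁
    L₂ = secondPart W₁ Y W₂
    |W₁|≡p : length W₁ ≡ p
    |W₁|≡p = ≡.trans (length-take p w) (m≤n⇒m⊓n≡m p≤|w|)
    |L₁|≡p : length L₁ ≡ p
    |L₁|≡p = ≡.trans (length-firstPart Y W₁) |W₁|≡p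
    w≡W₁++W₂ : w ≡ W₁ ++ W₂
    w≡W₁++W₂ = sym (take++drop≡id p w)

  maximalLift-descent-< : Unique Y → ∀ k → suc k < p →
                          IsDescent w (suc k) → IsDescent (maximalLift p Y w) (suc k)
  maximalLift-descent-< Y! k k<p w↘ =
    to (IsDescent-++ˡ L₁ L₂ k |L₁|≡p k<p)
      (firstPart-descent W₁ Y! (⊴⇒≼ Y⊴W₁) k (subst (suc k <_) (sym |W₁|≡p) k<p)
        (from (IsDescent-++ˡ W₁ W₂ k |W₁|≡p k<p) (subst (λ u → IsDescent u (suc k)) w≡W₁++W₂ w↘)))

  maximalLift-descent-> : length Y ≡ p → Unique w → ∀ k →
                          IsDescent w (suc (p + k)) → IsDescent (maximalLift p Y w) (suc (p + k))
  maximalLift-descent-> |Y|≡p w! k w↘ =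
    to (IsDescent-++ʳ L₁ L₂ k |L₁|≡p)
      (secondPart-descent W₂ (⊴⇒≼ Y⊴W₁) (≡.trans |W₁|≡p (sym |Y|≡p)) W₂W₁! k
        (from (IsDescent-++ʳ W₁ W₂ k |W₁|≡p) (subst (λ u → IsDescent u (suc (p + k))) w≡W₁++W₂ w↘)))
    where
    W₂W₁! : Unique (W₂ ++ W₁)
    W₂W₁! = Unique-resp-↭ (++-comm W₁ W₂) (subst Unique w≡W₁++W₂ w!)

maximalLift-descent : ∀ {p Y w} → Unique Y → length Y ≡ p → Unique w → p ≤ length w → Y ⊴ take p w →
                      ∀ k → suc k ≢ p → IsDescent w (suc k) → IsDescent (maximalLift p Y w) (suc k)
maximalLift-descent {p} Y! |Y|≡p w! p≤|w| Y⊴W₁ k i≢p w↘ with <-cmp (suc k) p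
... | tri< i<p _ _ = maximalLift-descent-< Y⊴W₁ p≤|w| Y! k i<p w↘
... | tri≈ _ i≡p _ = contradiction i≡p i≢p
... | tri> _ _ p<i with m≤n⇒∃[o]m+o≡n (s≤s⁻¹ p<i)
...   | j , refl = maximalLift-descent-> Y⊴W₁ p≤|w| |Y|≡p w! j w↘

proposition5p5 : (n p : ℕ) (Y w : List ℕ) →
    1 ≤ p → p ≤ n →
    Unique Y → length Y ≡ p →
    All (_∈ [ n ]) Y →
    w ↭ [ n ] →
    Y ⊴ take p w →
    (i : ℕ) → 1 ≤ i → i < n → i ≢ p →
    IsDescent w i → IsDescent (maximalLift p Y w) i
proposition5p5 n p Y w _ _ _ _ _ _ _ zero () _ _
proposition5p5 n p Y w _ p≤n Y! |Y|≡p _ w↭[n] Y⊴W₁ (suc k) _ _ =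
  maximalLift-descent Y! |Y|≡p w! (subst (p ≤_) (sym |w|≡n) p≤n) Y⊴W₁ k
  where
  w! : Unique w
  w! = Unique-resp-↭ (↭-sym w↭[n]) (map⁺ suc-injective (upTo⁺ n))
  |w|≡n : length w ≡ n
  |w|≡n = ≡.trans (↭-length w↭[n]) (≡.trans (length-map suc (upTo n)) (length-upTo n))
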